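{- Let $n=2k$ and let $A_n$ be the unique connected anti-regular graph on $n$ vertices, with its vertices labeled so that its adjacency matrix has the block form \[ A = \begin{pmatrix} 0 & B \\ B & J-I \end{pmatrix}, \] where $J$ is the $k\times k$ all-ones matrix, $I$ is the $k\times k$ identity matrix, and $B$ is the $k\times k$ Hankel matrix with entries $B(i,j)=1$ if $i+j\geq k+1$ and $B(i,j)=0$ otherwise (ones on and below the anti-diagonal). Then \[ A^{ -1} = \begin{pmatrix} V & W \\ W & 0 \end{pmatrix} \] where $W=B^{ -1}$ and $V=-B^{ -1}(J-I)B^{ -1}$. Explicitly, $W$ is the $k\times k$ Hankel matrix with $W(i,j)=1$ if $i+j=k+1$, $W(i,j)=-1$ if $i+j=k$, and $W(i,j)=0$ otherwise; and $V$ is the $k\times k$ symmetric tridiagonal matrix with diagonal entries $2,2,\ldots,2,0$ (all equal to $2$ except the last, which is $0$) and all sub- and super-diagonal entries equal to $-1$.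
   Context: The anti-regular graph $A_n$ is the unique connected graph on $n$ vertices having exactly two vertices of equal degree. For $n=2k$, relabeling its vertices so that degrees are non-decreasing yields the block adjacency matrix above. -}

module Defs where

open import Data.Nat as ℕ using (ℕ; zero; suc)
open import Data.Integer using (ℤ; +_; -_; _+_; _*_; 0ℤ; 1ℤ; -1ℤ)
open import Data.Fin using (Fin; toℕ; splitAt)
open import Data.Sum using (inj₁; inj₂)
open import Data.Bool using (if_then_else_)
open import Relation.Nullary.Decidable using (⌊_⌋)
open import Relation.Binary.PropositionalEquality using (_≡_)

-- Square integer matrices as functions on indices (0-based Fin; paper uses 1-based).
Matrix : ℕ → Set
Matrix n = Fin n → Fin n → ℤ

sumFin : ∀ {n} → (Fin n → ℤ) → ℤ
sumFin {zero}  f = 0ℤ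
sumFin {suc n} f = f Data.Fin.zero + sumFin (λ i → f (Data.Fin.suc i))


infixl 7 _⊗_
_⊗_ : ∀ {n} → Matrix n → Matrix n → Matrix n
(M ⊗ N) i j = sumFin (λ l → M i l * N l j)

negM : ∀ {n} → Matrix n → Matrix n
negM M i j = - M i j

_⊖_ : ∀ {n} → Matrix n → Matrix n → Matrix n
(M ⊖ N) i j = M i j + - N i j

zeroM : ∀ {n} → Matrix n
zeroM i j = 0ℤ

I : ∀ {n} → Matrix n
I i j = if ⌊ toℕ i ℕ.≟ toℕ j ⌋ then 1ℤ else 0ℤ

J : ∀ {n} → Matrix n
J i j = 1ℤ

block : ∀ {k} → Matrix k → Matrix k → Matrix k → Matrix k → Matrix (k ℕ.+ k)
block {k} P Q R S i j with splitAt k i | splitAt k j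
... | inj₁ a | inj₁ b = P a b
... | inj₁ a | inj₂ b = Q a b
... | inj₂ a | inj₁ b = R a b
... | inj₂ a | inj₂ b = S a b

-- With 1-based indices i' = toℕ i + 1, j' = toℕ j + 1:
-- B(i',j') = 1 iff i' + j' ≥ k + 1, i.e. k ≤ toℕ i + toℕ j + 1.
B : ∀ k → Matrix k
B k i j = if ⌊ k ℕ.≤? suc (toℕ i ℕ.+ toℕ j) ⌋ then 1ℤ else 0ℤ

A : ∀ k → Matrix (k ℕ.+ k)
A k = block zeroM (B k) (B k) (J ⊖ I)

-- W(i',j') = 1 if i'+j' = k+1, -1 if i'+j' = k, 0 otherwise.
-- In 0-based terms: i'+j' = toℕ i + toℕ j + 2.
W : ∀ k → Matrix k
W k i j =
  if ⌊ suc (suc (toℕ i ℕ.+ toℕ j)) ℕ.≟ suc k ⌋ then 1ℤ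
  else (if ⌊ suc (suc (toℕ i ℕ.+ toℕ j)) ℕ.≟ k ⌋ then -1ℤ else 0ℤ)

V : ∀ k → Matrix k
V k i j =
  if ⌊ toℕ i ℕ.≟ toℕ j ⌋
    then (if ⌊ suc (toℕ i) ℕ.≟ k ⌋ then 0ℤ else + 2)
    else (if ⌊ suc (toℕ i) ℕ.≟ toℕ j ⌋ then -1ℤ
          else (if ⌊ suc (toℕ j) ℕ.≟ toℕ i ⌋ then -1ℤ else 0ℤ))

Ainv : ∀ k → Matrix (k ℕ.+ k)
Ainv k = block (V k) (W k) (W k) zeroM

infix 4 _≐_
_≐_ : ∀ {n} → Matrix n → Matrix n → Set
M ≐ N = ∀ i j → M i j ≡ N i j

-- Hence if W
--     is a two-sided inverse of B, then [[0, B], [B, C]] has the inverse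
--     [[-W C W, W], [W, 0]] (the Schur complement of the zero corner).
--  3. Column y of W is e_d − e_{d−1} for the reversed index d = k − 1 − y, so
--     right multiplication by W is a backward difference.  Applied to the step
--     rows of B it gives B W = I, and W B = I follows by symmetry.  Applied twice
--     to J − I it gives a second difference, which a finite case check in the
--     reversed coordinates identifies with −V.
--  4. The theorem is step 2 with C = J − I, fed with the facts of step 3.
module Submission where

open import Defs
open import Data.Nat as ℕ using (ℕ; zero; suc; _≡ᵇ_; _≤ᵇ_; _<ᵇ_; _<_; _≤_)
import Data.Nat.Properties as ℕP
open import Data.Integer using (ℤ; +_; -_; _+_; _*_; 0ℤ; 1ℤ; -1ℤ)
import Data.Integer.Properties as ℤP
open import Data.Fin using (Fin; toℕ; fromℕ<; opposite; _↑ˡ_; _↑ʳ_; join; splitAt)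
  renaming (zero to fzero; suc to fsuc)
open import Data.Fin.Properties using (toℕ<n; toℕ-fromℕ<; opposite-prop; toℕ-↑ˡ; toℕ-↑ʳ; splitAt-join; join-splitAt)
open import Data.Sum using (_⊎_; inj₁; inj₂)
open import Data.Bool using (Bool; false; if_then_else_)
open import Data.Product using (_×_; _,_)
open import Function using (_∘_)
open import Relation.Nullary.Decidable using (⌊_⌋; isYes≗does; dec-false; does-⇔)
open import Function.Bundles using (_⇔_; mk⇔; Equivalence)
open import Relation.Nullary using (Dec; does)
open import Relation.Binary.PropositionalEquality hiding (J)
open import Algebra.Properties.Semiring.Sum ℤP.+-*-semiring
  using (sum; sum-cong-≗; sum-replicate-zero; ∑-distrib-+; ∑-comm; *-distribˡ-sum; *-distribʳ-sum)

open ≡-Reasoning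

sumFin≡sum : ∀ {n} (f : Fin n → ℤ) → sumFin f ≡ sum f
sumFin≡sum {zero}  f = refl
sumFin≡sum {suc n} f = cong (_+_ (f fzero)) (sumFin≡sum (f ∘ fsuc))

⊗-entry : ∀ {n} (M N : Matrix n) i j → (M ⊗ N) i j ≡ sum (λ l → M i l * N l j)
⊗-entry M N i j = sumFin≡sum (λ l → M i l * N l j)

sum-zero : ∀ {n} (f : Fin n → ℤ) → (∀ l → f l ≡ 0ℤ) → sum f ≡ 0ℤ
sum-zero {n} f f≡0 = trans (sum-cong-≗ f≡0) (sum-replicate-zero n)

sum-neg : ∀ {n} (f : Fin n → ℤ) → sum (λ l → - f l) ≡ - sum f
sum-neg f = begin
  sum (λ l → - f l)        ≡⟨ sum-cong-≗ (λ l → ℤP.-1*i≡-i (f l)) ⟨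
  sum (λ l → -1ℤ * f l)    ≡⟨ *-distribˡ-sum -1ℤ f ⟨
  -1ℤ * sum f              ≡⟨ ℤP.-1*i≡-i (sum f) ⟩
  - sum f                  ∎

sum-minus : ∀ {n} (f h : Fin n → ℤ) → sum (λ l → f l + - h l) ≡ sum f + - sum h
sum-minus f h = trans (∑-distrib-+ f (λ l → - h l)) (cong (_+_ (sum f)) (sum-neg h))

sum-split : ∀ m {n} (f : Fin (m ℕ.+ n) → ℤ) →
  sum f ≡ sum (λ a → f (a ↑ˡ n)) + sum (λ c → f (m ↑ʳ c))
sum-split zero    f = sym (ℤP.+-identityˡ _)
sum-split (suc m) f =
  trans (cong (_+_ (f fzero)) (sum-split m (f ∘ fsuc)))
        (sym (ℤP.+-assoc (f fzero) _ _))

≐-refl : ∀ {n} (M : Matrix n) → M ≐ M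
≐-refl M i j = refl

≐-trans : ∀ {n} {M N P : Matrix n} → M ≐ N → N ≐ P → M ≐ P
≐-trans M≐N N≐P i j = trans (M≐N i j) (N≐P i j)

ind : Bool → ℤ
ind c = if c then 1ℤ else 0ℤ

δ : ℕ → ℕ → ℤ
δ p m = ind (m ≡ᵇ p)

≡ᵇ-sym : ∀ m n → (m ≡ᵇ n) ≡ (n ≡ᵇ m)
≡ᵇ-sym zero    zero    = refl
≡ᵇ-sym zero    (suc n) = refl
≡ᵇ-sym (suc m) zero    = refl
≡ᵇ-sym (suc m) (suc n) = ≡ᵇ-sym m n

I-entry : ∀ {n} (i j : Fin n) → I i j ≡ δ (toℕ j) (toℕ i)
I-entry i j = cong ind (isYes≗does (toℕ i ℕP.≟ toℕ j))

I-sym : ∀ {n} (i j : Fin n) → I i j ≡ I j i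
I-sym i j = begin
  I i j                  ≡⟨ I-entry i j ⟩
  ind (toℕ i ≡ᵇ toℕ j)   ≡⟨ cong ind (≡ᵇ-sym (toℕ i) (toℕ j)) ⟩
  ind (toℕ j ≡ᵇ toℕ i)   ≡⟨ I-entry j i ⟨
  I j i                  ∎

sift : ∀ {n} (f : Fin n → ℤ) (i : Fin n) → sum (λ l → f l * δ (toℕ i) (toℕ l)) ≡ f i
sift f fzero = begin
  f fzero * 1ℤ + sum (λ l → f (fsuc l) * 0ℤ)
    ≡⟨ cong₂ _+_ (ℤP.*-identityʳ (f fzero)) (sum-zero _ (λ l → ℤP.*-zeroʳ (f (fsuc l)))) ⟩
  f fzero + 0ℤ
    ≡⟨ ℤP.+-identityʳ _ ⟩
  f fzero ∎
sift f (fsuc i) = begin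
  f fzero * 0ℤ + sum (λ l → f (fsuc l) * δ (toℕ i) (toℕ l))
    ≡⟨ cong₂ _+_ (ℤP.*-zeroʳ (f fzero)) (sift (f ∘ fsuc) i) ⟩
  0ℤ + f (fsuc i)
    ≡⟨ ℤP.+-identityˡ _ ⟩
  f (fsuc i) ∎

⊗-identityʳ : ∀ {n} (M : Matrix n) → M ⊗ I ≐ M
⊗-identityʳ M i j = begin
  (M ⊗ I) i j                                 ≡⟨ ⊗-entry M I i j ⟩
  sum (λ l → M i l * I l j)                   ≡⟨ sum-cong-≗ (λ l → cong (M i l *_) (I-entry l j)) ⟩
  sum (λ l → M i l * δ (toℕ j) (toℕ l))       ≡⟨ sift (M i) j ⟩
  M i j                                       ∎

⊗-identityˡ : ∀ {n} (M : Matrix n) → I ⊗ M ≐ M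
⊗-identityˡ M i j = begin
  (I ⊗ M) i j                                 ≡⟨ ⊗-entry I M i j ⟩
  sum (λ l → I i l * M l j)                   ≡⟨ sum-cong-≗ (λ l → trans (ℤP.*-comm (I i l) _) (cong (M l j *_) (I-sym i l))) ⟩
  sum (λ l → M l j * I l i)                   ≡⟨ sum-cong-≗ (λ l → cong (M l j *_) (I-entry l i)) ⟩
  sum (λ l → M l j * δ (toℕ i) (toℕ l))       ≡⟨ sift (λ l → M l j) i ⟩
  M i j                                       ∎

⊗-zeroˡ : ∀ {n} (M : Matrix n) → zeroM ⊗ M ≐ zeroM
⊗-zeroˡ M i j = trans (⊗-entry zeroM M i j) (sum-zero _ (λ l → ℤP.*-zeroˡ (M l j)))

⊗-zeroʳ : ∀ {n} (M : Matrix n) → M ⊗ zeroM ≐ zeroM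
⊗-zeroʳ M i j = trans (⊗-entry M zeroM i j) (sum-zero _ (λ l → ℤP.*-zeroʳ (M i l)))

⊗-negˡ : ∀ {n} (M N : Matrix n) → negM M ⊗ N ≐ negM (M ⊗ N)
⊗-negˡ M N i j = begin
  (negM M ⊗ N) i j                  ≡⟨ ⊗-entry (negM M) N i j ⟩
  sum (λ l → - M i l * N l j)       ≡⟨ sum-cong-≗ (λ l → sym (ℤP.neg-distribˡ-* (M i l) (N l j))) ⟩
  sum (λ l → - (M i l * N l j))     ≡⟨ sum-neg (λ l → M i l * N l j) ⟩
  - sum (λ l → M i l * N l j)       ≡⟨ cong -_ (⊗-entry M N i j) ⟨
  - (M ⊗ N) i j                     ∎

⊗-negʳ : ∀ {n} (M N : Matrix n) → M ⊗ negM N ≐ negM (M ⊗ N)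
⊗-negʳ M N i j = begin
  (M ⊗ negM N) i j                  ≡⟨ ⊗-entry M (negM N) i j ⟩
  sum (λ l → M i l * - N l j)       ≡⟨ sum-cong-≗ (λ l → sym (ℤP.neg-distribʳ-* (M i l) (N l j))) ⟩
  sum (λ l → - (M i l * N l j))     ≡⟨ sum-neg (λ l → M i l * N l j) ⟩
  - sum (λ l → M i l * N l j)       ≡⟨ cong -_ (⊗-entry M N i j) ⟨
  - (M ⊗ N) i j                     ∎

⊗-cong : ∀ {n} {M M′ N N′ : Matrix n} → M ≐ M′ → N ≐ N′ → M ⊗ N ≐ M′ ⊗ N′
⊗-cong M≐M′ N≐N′ i j = sumFin-cong (λ l → cong₂ _*_ (M≐M′ i l) (N≐N′ l j))
  where
  sumFin-cong : ∀ {n} {f g : Fin n → ℤ} → (∀ l → f l ≡ g l) → sumFin f ≡ sumFin g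
  sumFin-cong {f = f} {g} f≗g = trans (sumFin≡sum f) (trans (sum-cong-≗ f≗g) (sym (sumFin≡sum g)))

-- Associativity: both sides are the double sum Σ_l Σ_m M i m * N m l * P l j.
⊗-assoc : ∀ {n} (M N P : Matrix n) → (M ⊗ N) ⊗ P ≐ M ⊗ (N ⊗ P)
⊗-assoc M N P i j = begin
  ((M ⊗ N) ⊗ P) i j
    ≡⟨ ⊗-entry (M ⊗ N) P i j ⟩
  sum (λ l → (M ⊗ N) i l * P l j)
    ≡⟨ sum-cong-≗ (λ l → cong (_* P l j) (⊗-entry M N i l)) ⟩
  sum (λ l → sum (λ m → M i m * N m l) * P l j)
    ≡⟨ sum-cong-≗ (λ l → *-distribʳ-sum (P l j) (λ m → M i m * N m l)) ⟩
  sum (λ l → sum (λ m → M i m * N m l * P l j))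
    ≡⟨ ∑-comm (λ l m → M i m * N m l * P l j) ⟩
  sum (λ m → sum (λ l → M i m * N m l * P l j))
    ≡⟨ sum-cong-≗ (λ m → sum-cong-≗ (λ l → ℤP.*-assoc (M i m) (N m l) (P l j))) ⟩
  sum (λ m → sum (λ l → M i m * (N m l * P l j)))
    ≡⟨ sum-cong-≗ (λ m → *-distribˡ-sum (M i m) (λ l → N m l * P l j)) ⟨
  sum (λ m → M i m * sum (λ l → N m l * P l j))
    ≡⟨ sum-cong-≗ (λ m → cong (M i m *_) (⊗-entry N P m j)) ⟨
  sum (λ m → M i m * (N ⊗ P) m j)
    ≡⟨ ⊗-entry M (N ⊗ P) i j ⟨
  (M ⊗ (N ⊗ P)) i j ∎

Symmetric : ∀ {n} → Matrix n → Set
Symmetric M = ∀ i j → M i j ≡ M j i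

⊗-transpose : ∀ {n} {M N : Matrix n} → Symmetric M → Symmetric N →
  ∀ i j → (M ⊗ N) i j ≡ (N ⊗ M) j i
⊗-transpose {M = M} {N} M-sym N-sym i j = begin
  (M ⊗ N) i j                 ≡⟨ ⊗-entry M N i j ⟩
  sum (λ l → M i l * N l j)   ≡⟨ sum-cong-≗ (λ l → trans (ℤP.*-comm (M i l) (N l j)) (cong₂ _*_ (N-sym l j) (M-sym i l))) ⟩
  sum (λ l → N j l * M l i)   ≡⟨ ⊗-entry N M j i ⟨
  (N ⊗ M) j i                 ∎

infixl 6 _⊕_
_⊕_ : ∀ {n} → Matrix n → Matrix n → Matrix n
(M ⊕ N) i j = M i j + N i j

⊕-cong : ∀ {n} {M M′ N N′ : Matrix n} → M ≐ M′ → N ≐ N′ → M ⊕ N ≐ M′ ⊕ N′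
⊕-cong M≐M′ N≐N′ i j = cong₂ _+_ (M≐M′ i j) (N≐N′ i j)

⊕-identityˡ : ∀ {n} (M : Matrix n) → zeroM ⊕ M ≐ M
⊕-identityˡ M i j = ℤP.+-identityˡ (M i j)

⊕-identityʳ : ∀ {n} (M : Matrix n) → M ⊕ zeroM ≐ M
⊕-identityʳ M i j = ℤP.+-identityʳ (M i j)

⊕-cancel : ∀ {n} {M N : Matrix n} → M ≐ negM N → M ⊕ N ≐ zeroM
⊕-cancel {M = M} {N} M≐-N i j = trans (cong (_+ N i j) (M≐-N i j)) (ℤP.+-inverseˡ (N i j))

quadrant : ∀ {k} → Matrix k → Matrix k → Matrix k → Matrix k → Fin k ⊎ Fin k → Fin k ⊎ Fin k → ℤ
quadrant P Q R S (inj₁ a) (inj₁ c) = P a c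
quadrant P Q R S (inj₁ a) (inj₂ c) = Q a c
quadrant P Q R S (inj₂ a) (inj₁ c) = R a c
quadrant P Q R S (inj₂ a) (inj₂ c) = S a c

block-join : ∀ {k} (P Q R S : Matrix k) s t → block P Q R S (join k k s) (join k k t) ≡ quadrant P Q R S s t
block-join {k} P Q R S (inj₁ a) (inj₁ c) rewrite splitAt-join k k (inj₁ a) | splitAt-join k k (inj₁ c) = refl
block-join {k} P Q R S (inj₁ a) (inj₂ c) rewrite splitAt-join k k (inj₁ a) | splitAt-join k k (inj₂ c) = refl
block-join {k} P Q R S (inj₂ a) (inj₁ c) rewrite splitAt-join k k (inj₂ a) | splitAt-join k k (inj₁ c) = refl
block-join {k} P Q R S (inj₂ a) (inj₂ c) rewrite splitAt-join k k (inj₂ a) | splitAt-join k k (inj₂ c) = refl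

quadrant-ext : ∀ {k} {M N : Matrix (k ℕ.+ k)} →
  (∀ s t → M (join k k s) (join k k t) ≡ N (join k k s) (join k k t)) → M ≐ N
quadrant-ext {k} {M} {N} agree i j =
  subst₂ (λ i′ j′ → M i′ j′ ≡ N i′ j′) (join-splitAt k k i) (join-splitAt k k j)
         (agree (splitAt k i) (splitAt k j))

block-cong : ∀ {k} {P Q R S P′ Q′ R′ S′ : Matrix k} →
  P ≐ P′ → Q ≐ Q′ → R ≐ R′ → S ≐ S′ → block P Q R S ≐ block P′ Q′ R′ S′
block-cong {P = P} {Q} {R} {S} {P′} {Q′} {R′} {S′} P≐ Q≐ R≐ S≐ = quadrant-ext λ s t → begin
  block P Q R S (join _ _ s) (join _ _ t)       ≡⟨ block-join P Q R S s t ⟩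
  quadrant P Q R S s t                          ≡⟨ go s t ⟩
  quadrant P′ Q′ R′ S′ s t                      ≡⟨ block-join P′ Q′ R′ S′ s t ⟨
  block P′ Q′ R′ S′ (join _ _ s) (join _ _ t)   ∎
  where
  go : ∀ s t → quadrant P Q R S s t ≡ quadrant P′ Q′ R′ S′ s t
  go (inj₁ a) (inj₁ c) = P≐ a c
  go (inj₁ a) (inj₂ c) = Q≐ a c
  go (inj₂ a) (inj₁ c) = R≐ a c
  go (inj₂ a) (inj₂ c) = S≐ a c

block-⊗ : ∀ {k} (P Q R S P′ Q′ R′ S′ : Matrix k) →
  block P Q R S ⊗ block P′ Q′ R′ S′ ≐
  block (P ⊗ P′ ⊕ Q ⊗ R′) (P ⊗ Q′ ⊕ Q ⊗ S′) (R ⊗ P′ ⊕ S ⊗ R′) (R ⊗ Q′ ⊕ S ⊗ S′)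
block-⊗ {k} P Q R S P′ Q′ R′ S′ = quadrant-ext λ s t → begin
  (X ⊗ Y) (join k k s) (join k k t)
    ≡⟨ ⊗-entry X Y _ _ ⟩
  sum (λ l → X (join k k s) l * Y l (join k k t))
    ≡⟨ sum-split k _ ⟩
  sum (λ a → X (join k k s) (a ↑ˡ k) * Y (a ↑ˡ k) (join k k t))
    + sum (λ c → X (join k k s) (k ↑ʳ c) * Y (k ↑ʳ c) (join k k t))
    ≡⟨ cong₂ _+_ (sum-cong-≗ (λ a → cong₂ _*_ (block-join P Q R S s (inj₁ a)) (block-join P′ Q′ R′ S′ (inj₁ a) t)))
                 (sum-cong-≗ (λ c → cong₂ _*_ (block-join P Q R S s (inj₂ c)) (block-join P′ Q′ R′ S′ (inj₂ c) t))) ⟩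
  sum (λ a → quadrant P Q R S s (inj₁ a) * quadrant P′ Q′ R′ S′ (inj₁ a) t)
    + sum (λ c → quadrant P Q R S s (inj₂ c) * quadrant P′ Q′ R′ S′ (inj₂ c) t)
    ≡⟨ by-quadrant s t ⟩
  quadrant (P ⊗ P′ ⊕ Q ⊗ R′) (P ⊗ Q′ ⊕ Q ⊗ S′) (R ⊗ P′ ⊕ S ⊗ R′) (R ⊗ Q′ ⊕ S ⊗ S′) s t
    ≡⟨ block-join _ _ _ _ s t ⟨
  block (P ⊗ P′ ⊕ Q ⊗ R′) (P ⊗ Q′ ⊕ Q ⊗ S′) (R ⊗ P′ ⊕ S ⊗ R′) (R ⊗ Q′ ⊕ S ⊗ S′) (join k k s) (join k k t) ∎
  where
  X Y : Matrix (k ℕ.+ k)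
  X = block P Q R S
  Y = block P′ Q′ R′ S′
  by-quadrant : ∀ s t →
    sum (λ a → quadrant P Q R S s (inj₁ a) * quadrant P′ Q′ R′ S′ (inj₁ a) t)
      + sum (λ c → quadrant P Q R S s (inj₂ c) * quadrant P′ Q′ R′ S′ (inj₂ c) t)
    ≡ quadrant (P ⊗ P′ ⊕ Q ⊗ R′) (P ⊗ Q′ ⊕ Q ⊗ S′) (R ⊗ P′ ⊕ S ⊗ R′) (R ⊗ Q′ ⊕ S ⊗ S′) s t
  by-quadrant (inj₁ a) (inj₁ c) = sym (cong₂ _+_ (⊗-entry P P′ a c) (⊗-entry Q R′ a c))
  by-quadrant (inj₁ a) (inj₂ c) = sym (cong₂ _+_ (⊗-entry P Q′ a c) (⊗-entry Q S′ a c))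
  by-quadrant (inj₂ a) (inj₁ c) = sym (cong₂ _+_ (⊗-entry R P′ a c) (⊗-entry S R′ a c))
  by-quadrant (inj₂ a) (inj₂ c) = sym (cong₂ _+_ (⊗-entry R Q′ a c) (⊗-entry S S′ a c))

δ-≢ : ∀ {m p} → m ≢ p → δ p m ≡ 0ℤ
δ-≢ {m} {p} m≢p = cong ind (dec-false (m ℕP.≟ p) m≢p)

≡ᵇ-cancelˡ : ∀ k m n → (k ℕ.+ m ≡ᵇ k ℕ.+ n) ≡ (m ≡ᵇ n)
≡ᵇ-cancelˡ zero    m n = refl
≡ᵇ-cancelˡ (suc k) m n = ≡ᵇ-cancelˡ k m n

I-block : ∀ {k} → I ≐ block {k} I zeroM zeroM I
I-block {k} = quadrant-ext λ s t → trans (I-quadrant s t) (sym (block-join I zeroM zeroM I s t))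
  where
  left<right : ∀ (a c : Fin k) → toℕ (a ↑ˡ k) ≢ toℕ (k ↑ʳ c)
  left<right a c eq = ℕP.<⇒≢ (ℕP.<-≤-trans (toℕ<n a) (ℕP.m≤m+n k (toℕ c)))
                             (trans (sym (toℕ-↑ˡ a k)) (trans eq (toℕ-↑ʳ k c)))
  I-quadrant : ∀ s t → I (join k k s) (join k k t) ≡ quadrant I zeroM zeroM I s t
  I-quadrant (inj₁ a) (inj₁ c) = begin
    I (a ↑ˡ k) (c ↑ˡ k)                    ≡⟨ I-entry (a ↑ˡ k) (c ↑ˡ k) ⟩
    δ (toℕ (c ↑ˡ k)) (toℕ (a ↑ˡ k))        ≡⟨ cong₂ δ (toℕ-↑ˡ c k) (toℕ-↑ˡ a k) ⟩
    δ (toℕ c) (toℕ a)                      ≡⟨ I-entry a c ⟨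
    I a c                                  ∎
  I-quadrant (inj₁ a) (inj₂ c) = trans (I-entry (a ↑ˡ k) (k ↑ʳ c)) (δ-≢ (left<right a c))
  I-quadrant (inj₂ a) (inj₁ c) = trans (I-entry (k ↑ʳ a) (c ↑ˡ k)) (δ-≢ (≢-sym (left<right c a)))
  I-quadrant (inj₂ a) (inj₂ c) = begin
    I (k ↑ʳ a) (k ↑ʳ c)                    ≡⟨ I-entry (k ↑ʳ a) (k ↑ʳ c) ⟩
    δ (toℕ (k ↑ʳ c)) (toℕ (k ↑ʳ a))        ≡⟨ cong₂ δ (toℕ-↑ʳ k c) (toℕ-↑ʳ k a) ⟩
    δ (k ℕ.+ toℕ c) (k ℕ.+ toℕ a)          ≡⟨ cong ind (≡ᵇ-cancelˡ k (toℕ a) (toℕ c)) ⟩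
    δ (toℕ c) (toℕ a)                      ≡⟨ I-entry a c ⟨
    I a c                                  ∎

-- If W = B⁻¹ then B ⊗ (-(W C W)) = -(C W) and (-(W C W)) ⊗ B = -(W C):
-- these are the off-diagonal blocks of the Schur-complement inverse.
schurˡ : ∀ {k} (B W C : Matrix k) → B ⊗ W ≐ I → B ⊗ negM (W ⊗ C ⊗ W) ≐ negM (C ⊗ W)
schurˡ B W C BW≐I i j = begin
  (B ⊗ negM (W ⊗ C ⊗ W)) i j      ≡⟨ ⊗-negʳ B (W ⊗ C ⊗ W) i j ⟩
  - (B ⊗ (W ⊗ C ⊗ W)) i j         ≡⟨ cong -_ (⊗-cong (≐-refl B) (⊗-assoc W C W) i j) ⟩
  - (B ⊗ (W ⊗ (C ⊗ W))) i j       ≡⟨ cong -_ (⊗-assoc B W (C ⊗ W) i j) ⟨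
  - (B ⊗ W ⊗ (C ⊗ W)) i j         ≡⟨ cong -_ (⊗-cong BW≐I (≐-refl (C ⊗ W)) i j) ⟩
  - (I ⊗ (C ⊗ W)) i j             ≡⟨ cong -_ (⊗-identityˡ (C ⊗ W) i j) ⟩
  - (C ⊗ W) i j                   ∎

schurʳ : ∀ {k} (B W C : Matrix k) → W ⊗ B ≐ I → negM (W ⊗ C ⊗ W) ⊗ B ≐ negM (W ⊗ C)
schurʳ B W C WB≐I i j = begin
  (negM (W ⊗ C ⊗ W) ⊗ B) i j      ≡⟨ ⊗-negˡ (W ⊗ C ⊗ W) B i j ⟩
  - (W ⊗ C ⊗ W ⊗ B) i j           ≡⟨ cong -_ (⊗-assoc (W ⊗ C) W B i j) ⟩
  - (W ⊗ C ⊗ (W ⊗ B)) i j         ≡⟨ cong -_ (⊗-cong (≐-refl (W ⊗ C)) WB≐I i j) ⟩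
  - (W ⊗ C ⊗ I) i j               ≡⟨ cong -_ (⊗-identityʳ (W ⊗ C) i j) ⟩
  - (W ⊗ C) i j                   ∎

block-inverse : ∀ {k} (B W C V : Matrix k) → B ⊗ W ≐ I → W ⊗ B ≐ I → V ≐ negM (W ⊗ C ⊗ W) →
  (block zeroM B B C ⊗ block V W W zeroM ≐ I) × (block V W W zeroM ⊗ block zeroM B B C ≐ I)
block-inverse {k} B W C V BW≐I WB≐I V≐ =
    ≐-trans (block-⊗ zeroM B B C V W W zeroM)
      (≐-trans (block-cong
         (≐-trans (⊕-cong (⊗-zeroˡ V) BW≐I) (⊕-identityˡ I))
         (≐-trans (⊕-cong (⊗-zeroˡ W) (⊗-zeroʳ B)) (⊕-identityˡ zeroM))
         (⊕-cancel (≐-trans (⊗-cong (≐-refl B) V≐) (schurˡ B W C BW≐I)))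
         (≐-trans (⊕-cong BW≐I (⊗-zeroʳ C)) (⊕-identityʳ I)))
       (λ i j → sym (I-block {k} i j)))
  , ≐-trans (block-⊗ V W W zeroM zeroM B B C)
      (≐-trans (block-cong
         (≐-trans (⊕-cong (⊗-zeroʳ V) WB≐I) (⊕-identityˡ I))
         (⊕-cancel (≐-trans (⊗-cong V≐ (≐-refl B)) (schurʳ B W C WB≐I)))
         (≐-trans (⊕-cong (⊗-zeroʳ W) (⊗-zeroˡ B)) (⊕-identityˡ zeroM))
         (≐-trans (⊕-cong WB≐I (⊗-zeroˡ C)) (⊕-identityʳ I)))
       (λ i j → sym (I-block {k} i j)))

sumℕ : ℕ → (ℕ → ℤ) → ℤ
sumℕ n g = sum (λ (l : Fin n) → g (toℕ l))

sumℕ-sift : ∀ n p (g : ℕ → ℤ) → p < n → sumℕ n (λ m → g m * δ p m) ≡ g p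
sumℕ-sift n p g p<n = subst (λ q → sumℕ n (λ m → g m * δ q m) ≡ g q) (toℕ-fromℕ< p<n)
                            (sift (g ∘ toℕ) (fromℕ< p<n))

-- The backward shift g ↦ (d ↦ g (d - 1)), extended by zero at d = 0.
pre : (ℕ → ℤ) → ℕ → ℤ
pre g zero    = 0ℤ
pre g (suc d) = g d

sumℕ-sift-pre : ∀ n d (g : ℕ → ℤ) → d < n → sumℕ n (λ m → g m * ind (suc m ≡ᵇ d)) ≡ pre g d
sumℕ-sift-pre n zero    g _   = sum-zero {n} _ (λ l → ℤP.*-zeroʳ (g (toℕ l)))
sumℕ-sift-pre n (suc d) g d<n = sumℕ-sift n d g (ℕP.<-trans (ℕP.n<1+n d) d<n)

w : ℕ → ℕ → ℕ → ℤ
w k x y = if suc (suc (x ℕ.+ y)) ≡ᵇ suc k then 1ℤ else (if suc (suc (x ℕ.+ y)) ≡ᵇ k then -1ℤ else 0ℤ)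

W-entry : ∀ k (i j : Fin k) → W k i j ≡ w k (toℕ i) (toℕ j)
W-entry k i j = cong₂ (λ c₁ c₂ → if c₁ then 1ℤ else (if c₂ then -1ℤ else 0ℤ))
                      (isYes≗does (s ℕP.≟ suc k)) (isYes≗does (s ℕP.≟ k))
  where
  s : ℕ
  s = suc (suc (toℕ i ℕ.+ toℕ j))

step-down : ∀ m d → (if m ≡ᵇ d then 1ℤ else (if suc m ≡ᵇ d then -1ℤ else 0ℤ)) ≡ δ d m + - ind (suc m ≡ᵇ d)
step-down zero    zero          = refl
step-down zero    (suc zero)    = refl
step-down zero    (suc (suc d)) = refl
step-down (suc m) zero          = refl
step-down (suc m) (suc d)       = step-down m d

W-column : ∀ y d m → w (suc (y ℕ.+ d)) m y ≡ δ d m + - ind (suc m ≡ᵇ d)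
W-column y d m = trans (cong₂ (λ c₁ c₂ → if c₁ then 1ℤ else (if c₂ then -1ℤ else 0ℤ)) same₁ same₂)
                       (step-down m d)
  where
  same₁ : (m ℕ.+ y ≡ᵇ y ℕ.+ d) ≡ (m ≡ᵇ d)
  same₁ = trans (cong (_≡ᵇ y ℕ.+ d) (ℕP.+-comm m y)) (≡ᵇ-cancelˡ y m d)
  same₂ : (suc m ℕ.+ y ≡ᵇ y ℕ.+ d) ≡ (suc m ≡ᵇ d)
  same₂ = trans (cong (_≡ᵇ y ℕ.+ d) (ℕP.+-comm (suc m) y)) (≡ᵇ-cancelˡ y (suc m) d)

W-difference : ∀ n y d (g : ℕ → ℤ) → suc (y ℕ.+ d) ≡ n →
  sumℕ n (λ m → g m * w n m y) ≡ g d + - pre g d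
W-difference _ y d g refl = begin
  sumℕ k (λ m → g m * w k m y)
    ≡⟨ sum-cong-≗ {k} (λ l → trans (cong (g (toℕ l) *_) (W-column y d (toℕ l)))
                               (ℤP.*-distribˡ-+ (g (toℕ l)) (δ d (toℕ l)) (- ind (suc (toℕ l) ≡ᵇ d)))) ⟩
  sumℕ k (λ m → g m * δ d m + g m * - ind (suc m ≡ᵇ d))
    ≡⟨ sum-cong-≗ {k} (λ l → cong (_+_ (g (toℕ l) * δ d (toℕ l))) (sym (ℤP.neg-distribʳ-* (g (toℕ l)) (ind (suc (toℕ l) ≡ᵇ d))))) ⟩
  sumℕ k (λ m → g m * δ d m + - (g m * ind (suc m ≡ᵇ d)))
    ≡⟨ sum-minus {k} (λ l → g (toℕ l) * δ d (toℕ l)) (λ l → g (toℕ l) * ind (suc (toℕ l) ≡ᵇ d)) ⟩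
  sumℕ k (λ m → g m * δ d m) + - sumℕ k (λ m → g m * ind (suc m ≡ᵇ d))
    ≡⟨ cong₂ (λ p q → p + - q) (sumℕ-sift k d g d<k) (sumℕ-sift-pre k d g d<k) ⟩
  g d + - pre g d ∎
  where
  k : ℕ
  k = suc (y ℕ.+ d)
  d<k : d < k
  d<k = ℕ.s≤s (ℕP.m≤n+m d y)

opposite-spec : ∀ {k} (j : Fin k) → suc (toℕ j ℕ.+ toℕ (opposite j)) ≡ k
opposite-spec j = trans (cong (λ o → suc (toℕ j ℕ.+ o)) (opposite-prop j)) (ℕP.m+[n∸m]≡n (toℕ<n j))

⊗W-difference : ∀ {k} (M : Matrix k) (g : ℕ → ℤ) i j → (∀ l → M i l ≡ g (toℕ l)) →
  (M ⊗ W k) i j ≡ g (toℕ (opposite j)) + - pre g (toℕ (opposite j))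
⊗W-difference {k} M g i j row = begin
  (M ⊗ W k) i j                     ≡⟨ ⊗-entry M (W k) i j ⟩
  sum (λ l → M i l * W k l j)       ≡⟨ sum-cong-≗ (λ l → cong₂ _*_ (row l) (W-entry k l j)) ⟩
  sumℕ k (λ m → g m * w k m (toℕ j)) ≡⟨ W-difference k (toℕ j) (toℕ (opposite j)) g (opposite-spec j) ⟩
  g (toℕ (opposite j)) + - pre g (toℕ (opposite j)) ∎

b : ℕ → ℕ → ℕ → ℤ
b k x y = ind (k ≤ᵇ suc (x ℕ.+ y))

B-entry : ∀ k (i j : Fin k) → B k i j ≡ b k (toℕ i) (toℕ j)
B-entry k i j = cong ind (isYes≗does (k ℕP.≤? suc (toℕ i ℕ.+ toℕ j)))

B-step : ∀ y x d → b (suc (y ℕ.+ d)) x d ≡ ind (y ≤ᵇ x)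
B-step y x d = cong ind (does-⇔ (mk⇔ shrink grow) (suc (y ℕ.+ d) ℕP.≤? suc (x ℕ.+ d)) (y ℕP.≤? x))
  where
  shrink : suc (y ℕ.+ d) ≤ suc (x ℕ.+ d) → y ≤ x
  shrink le = ℕP.+-cancelʳ-≤ d y x (ℕ.s≤s⁻¹ le)
  grow : y ≤ x → suc (y ℕ.+ d) ≤ suc (x ℕ.+ d)
  grow le = ℕ.s≤s (ℕP.+-monoˡ-≤ d le)

<ᵇ-suc : ∀ m n → (m <ᵇ suc n) ≡ (m ≤ᵇ n)
<ᵇ-suc zero    n = refl
<ᵇ-suc (suc m) n = refl

staircase : ∀ x y → ind (y ≤ᵇ x) + - ind (suc y ≤ᵇ x) ≡ δ y x
staircase zero    zero    = refl
staircase zero    (suc y) = refl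
staircase (suc x) zero    = refl
staircase (suc x) (suc y) rewrite <ᵇ-suc y x = staircase x y

B-difference : ∀ n x y d → x < n → suc (y ℕ.+ d) ≡ n → b n x d + - pre (b n x) d ≡ δ y x
B-difference _ x y zero    x<n refl = begin
  b (suc (y ℕ.+ 0)) x 0 + - 0ℤ          ≡⟨ cong₂ (λ p q → p + - q) (B-step y x 0) (sym below) ⟩
  ind (y ≤ᵇ x) + - ind (suc y ≤ᵇ x)     ≡⟨ staircase x y ⟩
  δ y x                                 ∎
  where
  below : ind (suc y ≤ᵇ x) ≡ 0ℤ
  below = cong ind (dec-false (suc y ℕP.≤? x)
                    (ℕP.≤⇒≯ (ℕP.≤-trans (ℕ.s≤s⁻¹ x<n) (ℕP.≤-reflexive (ℕP.+-identityʳ y)))))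
B-difference _ x y (suc d) x<n refl = begin
  b n x (suc d) + - b n x d             ≡⟨ cong₂ (λ p q → p + - q) (B-step y x (suc d)) shifted ⟩
  ind (y ≤ᵇ x) + - ind (suc y ≤ᵇ x)     ≡⟨ staircase x y ⟩
  δ y x                                 ∎
  where
  n : ℕ
  n = suc (y ℕ.+ suc d)
  shifted : b n x d ≡ ind (suc y ≤ᵇ x)
  shifted = trans (cong (λ m → b (suc m) x d) (ℕP.+-suc y d)) (B-step (suc y) x d)

B⊗W : ∀ k → B k ⊗ W k ≐ I
B⊗W k i j = begin
  (B k ⊗ W k) i j                            ≡⟨ ⊗W-difference (B k) (b k (toℕ i)) i j (B-entry k i) ⟩
  b k (toℕ i) d + - pre (b k (toℕ i)) d      ≡⟨ B-difference k (toℕ i) (toℕ j) d (toℕ<n i) (opposite-spec j) ⟩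
  δ (toℕ j) (toℕ i)                          ≡⟨ I-entry i j ⟨
  I i j                                      ∎
  where
  d : ℕ
  d = toℕ (opposite j)

B-sym : ∀ k → Symmetric (B k)
B-sym k i j = cong (λ s → if ⌊ k ℕP.≤? suc s ⌋ then 1ℤ else 0ℤ) (ℕP.+-comm (toℕ i) (toℕ j))

W-sym : ∀ k → Symmetric (W k)
W-sym k i j = cong (λ s → if ⌊ suc (suc s) ℕP.≟ suc k ⌋ then 1ℤ else (if ⌊ suc (suc s) ℕP.≟ k ⌋ then -1ℤ else 0ℤ))
                   (ℕP.+-comm (toℕ i) (toℕ j))

C-sym : ∀ {k} → Symmetric (J ⊖ I {k})
C-sym i j = cong (λ z → 1ℤ + - z) (I-sym i j)

-- W is also a left inverse, by transposing B ⊗ W = I.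
W⊗B : ∀ k → W k ⊗ B k ≐ I
W⊗B k i j = begin
  (W k ⊗ B k) i j   ≡⟨ ⊗-transpose (W-sym k) (B-sym k) i j ⟩
  (B k ⊗ W k) j i   ≡⟨ B⊗W k j i ⟩
  I j i             ≡⟨ I-sym j i ⟩
  I i j             ∎

c : ℕ → ℕ → ℤ
c x y = 1ℤ + - δ y x

C-entry : ∀ {k} (i j : Fin k) → (J ⊖ I) i j ≡ c (toℕ i) (toℕ j)
C-entry i j = cong (λ z → 1ℤ + - z) (I-entry i j)

-- Row x of W ⊗ (J − I), as a function of the column m, where a = k − 1 − x.
X : ℕ → ℕ → ℤ
X a m = c m a + - pre (c m) a

W⊗C-row : ∀ {k} (i l : Fin k) → (W k ⊗ (J ⊖ I)) i l ≡ X (toℕ (opposite i)) (toℕ l)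
W⊗C-row {k} i l = trans (⊗-transpose (W-sym k) C-sym i l) (⊗W-difference (J ⊖ I) (c (toℕ l)) l i (C-entry l))

tridiag : Bool → Bool → Bool → Bool → ℤ
tridiag onDiag isLast above below =
  if onDiag then (if isLast then 0ℤ else + 2) else (if above then -1ℤ else (if below then -1ℤ else 0ℤ))

tridiag-cong : ∀ {p₁ p₂ p₃ p₄ q₁ q₂ q₃ q₄} → p₁ ≡ q₁ → p₂ ≡ q₂ → p₃ ≡ q₃ → p₄ ≡ q₄ →
  tridiag p₁ p₂ p₃ p₄ ≡ tridiag q₁ q₂ q₃ q₄
tridiag-cong refl refl refl refl = refl

isYes-⇔ : ∀ {P Q : Set} → P ⇔ Q → (p? : Dec P) (q? : Dec Q) → ⌊ p? ⌋ ≡ does q?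
isYes-⇔ P⇔Q p? q? = trans (isYes≗does p?) (does-⇔ P⇔Q p? q?)

same-iff : ∀ {x y a d} → x ℕ.+ a ≡ y ℕ.+ d → (x ≡ y ⇔ a ≡ d)
same-iff {x} {y} {a} {d} h = mk⇔ (λ { refl → ℕP.+-cancelˡ-≡ x a d h })
                                 (λ { refl → ℕP.+-cancelʳ-≡ a x y h })

next-iff : ∀ {x y a d} → x ℕ.+ a ≡ y ℕ.+ d → (suc x ≡ y ⇔ a ≡ suc d)
next-iff {x} {y} {a} {d} h = mk⇔ (λ { refl → ℕP.+-cancelˡ-≡ x a (suc d) (trans h (sym (ℕP.+-suc x d))) })
                                 (λ { refl → ℕP.+-cancelʳ-≡ d (suc x) y (trans (sym (ℕP.+-suc x d)) h) })

prev-iff : ∀ {x y a d} → x ℕ.+ a ≡ y ℕ.+ d → (suc y ≡ x ⇔ suc a ≡ d)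
prev-iff h = mk⇔ (λ e → sym (Equivalence.to (next-iff (sym h)) e))
                 (λ e → Equivalence.from (next-iff (sym h)) (sym e))

last-iff : ∀ x a → (suc x ≡ suc (x ℕ.+ a) ⇔ a ≡ 0)
last-iff x a = mk⇔ (λ e → sym (ℕP.+-cancelˡ-≡ x 0 a (trans (ℕP.+-identityʳ x) (ℕP.suc-injective e))))
                   (λ { refl → cong suc (sym (ℕP.+-identityʳ x)) })

V-reversed : ∀ {k} (i j : Fin k) →
  let a = toℕ (opposite i) ; d = toℕ (opposite j) in
  V k i j ≡ tridiag (a ≡ᵇ d) (a ≡ᵇ 0) (a ≡ᵇ suc d) (suc a ≡ᵇ d)
V-reversed {k} i j = reversed-tests k (toℕ i) (toℕ j) _ _ (opposite-spec i) (opposite-spec j)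
  where
  reversed-tests : ∀ k x y a d → suc (x ℕ.+ a) ≡ k → suc (y ℕ.+ d) ≡ k →
    tridiag ⌊ x ℕP.≟ y ⌋ ⌊ suc x ℕP.≟ k ⌋ ⌊ suc x ℕP.≟ y ⌋ ⌊ suc y ℕP.≟ x ⌋
      ≡ tridiag (a ≡ᵇ d) (a ≡ᵇ 0) (a ≡ᵇ suc d) (suc a ≡ᵇ d)
  reversed-tests _ x y a d refl hy = tridiag-cong
    (isYes-⇔ (same-iff h) (x ℕP.≟ y) (a ℕP.≟ d)) (isYes-⇔ (last-iff x a) (suc x ℕP.≟ _) (a ℕP.≟ 0))
    (isYes-⇔ (next-iff h) (suc x ℕP.≟ y) (a ℕP.≟ suc d)) (isYes-⇔ (prev-iff h) (suc y ℕP.≟ x) (suc a ℕP.≟ d))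
    where
    h : x ℕ.+ a ≡ y ℕ.+ d
    h = ℕP.suc-injective (sym hy)

V-table : ∀ a d → tridiag (a ≡ᵇ d) (a ≡ᵇ 0) (a ≡ᵇ suc d) (suc a ≡ᵇ d) ≡ - (X a d + - pre (X a) d)
V-table zero          zero          = refl
V-table zero          (suc zero)    = refl
V-table zero          (suc (suc d)) = refl
V-table (suc zero)    zero          = refl
V-table (suc (suc a)) zero          = refl
V-table (suc a)       (suc d)       = inner a d
  where
  -- Off the last row the last-entry test is false, and both sides recur on (a, d).
  inner : ∀ a d → tridiag (a ≡ᵇ d) false (a ≡ᵇ suc d) (suc a ≡ᵇ d) ≡ - (X (suc a) (suc d) + - pre (X (suc a)) (suc d))
  inner zero          zero          = refl
  inner zero          (suc zero)    = refl
  inner zero          (suc (suc d)) = refl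
  inner (suc zero)    zero          = refl
  inner (suc (suc a)) zero          = refl
  inner (suc a)       (suc d)       = inner a d

V-formula : ∀ k → V k ≐ negM (W k ⊗ (J ⊖ I) ⊗ W k)
V-formula k i j = begin
  V k i j
    ≡⟨ V-reversed i j ⟩
  tridiag (a ≡ᵇ d) (a ≡ᵇ 0) (a ≡ᵇ suc d) (suc a ≡ᵇ d)
    ≡⟨ V-table a d ⟩
  - (X a d + - pre (X a) d)
    ≡⟨ cong -_ (⊗W-difference (W k ⊗ (J ⊖ I)) (X a) i j (W⊗C-row i)) ⟨
  - (W k ⊗ (J ⊖ I) ⊗ W k) i j ∎
  where
  a d : ℕ
  a = toℕ (opposite i)
  d = toℕ (opposite j)

lemma4p2 : (k : ℕ) →
    ((A k ⊗ Ainv k ≐ I) × (Ainv k ⊗ A k ≐ I))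
    × ((B k ⊗ W k ≐ I) × (W k ⊗ B k ≐ I))
    × (V k ≐ negM (W k ⊗ (J ⊖ I) ⊗ W k))
lemma4p2 k =
  block-inverse (B k) (W k) (J ⊖ I) (V k) (B⊗W k) (W⊗B k) (V-formula k) , (B⊗W k , W⊗B k) , V-formula k
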